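{- Let $m$ be a composite number with prime factorization $m=p_{1}^{s_1}p_{2}^{s_2}\cdots p_{t}^{s_t}$, where $p_1,\dots,p_t$ are distinct primes and $s_1,\dots,s_t\ge 1$. Then \[ L(m)=\mathrm{lcm}\bigl(L(p_{1}^{s_1}),L(p_{2}^{s_2}),\ldots,L(p_{t}^{s_t})\bigr). \]
   Context: For an integer $m\ge 2$, a cycle modulo $m$ of length $k\ge 1$ is a sequence $x_1,\dots,x_k$ of pairwise distinct residues modulo $m$ such that $x_i^2\equiv x_{i+1}\pmod m$ for $1\le i\le k-1$ and $x_k^2\equiv x_1\pmod m$. $L(m)$ denotes the maximum length of a cycle modulo $m$. $\mathrm{lcm}$ denotes the least common multiple. -}

module Defs where

open import Data.Nat using (ℕ; zero; suc; _^_; _*_; _<_; _≤_)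
open import Data.Nat.LCM using (lcm)
open import Data.Nat.Primality using (Prime)
open import Data.Integer using (ℤ; +_; _-_)
import Data.Integer.Divisibility as ℤ
open import Data.Fin using (Fin; toℕ)
open import Data.List using (List; map; foldr)
open import Data.Nat.ListAction using (product)
open import Data.List.Relation.Unary.All using (All)
open import Data.List.Relation.Unary.Unique.Propositional using (Unique)
open import Data.List.Relation.Binary.Pointwise using (Pointwise)
open import Data.Product using (_×_; Σ; proj₁; proj₂)
open import Data.Sum using (_⊎_)
open import Relation.Binary.PropositionalEquality using (_≡_)
open import Function.Definitions using (Injective)

_≡_[mod_] : ℕ → ℕ → ℕ → Set
a ≡ b [mod m ] = (+ m) ℤ.∣ (+ a - + b)

CycSucc : {k : ℕ} → Fin k → Fin k → Set
CycSucc {k} i j = (toℕ j ≡ suc (toℕ i)) ⊎ ((suc (toℕ i) ≡ k) × (toℕ j ≡ 0))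

record IsCycle (m k : ℕ) (x : Fin k → ℕ) : Set where
  field
    length-pos : 1 ≤ k
    residue    : ∀ i → x i < m
    distinct   : Injective _≡_ _≡_ x
    squaring   : ∀ i j → CycSucc i j → (x i ^ 2) ≡ x j [mod m ]

-- "L(m) = l": l is the maximum length of a cycle modulo m.
IsL : ℕ → ℕ → Set
IsL m l = Σ (Fin l → ℕ) (IsCycle m l)
        × (∀ k (x : Fin k → ℕ) → IsCycle m k x → k ≤ l)

lcmList : List ℕ → ℕ
lcmList = foldr lcm 1

IsPrimeFactorisation : ℕ → List (ℕ × ℕ) → Set
IsPrimeFactorisation m fs =
    All (λ ps → Prime (proj₁ ps)) fs
  × Unique (map proj₁ fs)
  × All (λ ps → 1 ≤ proj₂ ps) fs
  × (m ≡ product (map (λ ps → proj₁ ps ^ proj₂ ps) fs))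

-- A cycle modulo m is the orbit of its first entry y under squaring, and its
-- length is the minimal period of y, the least k ≥ 1 with y^(2^k) ≡ y.  The
-- periods of y are closed under addition and subtraction, so the minimal
-- period divides every period.  Call L the period exponent modulo n if some
-- element has minimal period L and every minimal period divides L; then L is
-- the maximal cycle length L(n).  The proof shows:
--   * for coprime q, n the minimal period modulo q n is the lcm of those
--     modulo q and n, so by the Chinese remainder theorem period exponents of
--     coprime moduli combine to their lcm;
--   * modulo p^s the maximal cycle length is a period exponent: multiples of p
--     have period 1, and for units, where periods correspond to multiplicative
--     orders dividing 2^t - 1, an element whose order is the lcm of two given
--     orders shows that the largest minimal period is a multiple of all others.

module Submission where

open import Defs
open import Data.Nat.Primality
  using (Prime; Composite; prime⇒irreducible; prime⇒nonZero; prime⇒nonTrivial)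
open import Data.List using (List; []; _∷_; map)
open import Data.List.Relation.Unary.All using (All; []; _∷_)
open import Data.List.Relation.Unary.AllPairs using ([]; _∷_)
open import Data.List.Relation.Unary.Unique.Propositional using (Unique)
open import Data.Nat.ListAction using (product)
open import Data.List.Relation.Binary.Pointwise using (Pointwise; []; _∷_)
open import Data.Product using (_×_; proj₁; proj₂)

open import Data.Nat as ℕ
  using (ℕ; zero; suc; _+_; _*_; _∸_; _^_; _<_; _≤_; _≤?_; z≤n; s≤s; NonZero)
open import Data.Nat.Properties
open import Data.Nat.DivMod using (_%_; _/_; m≡m%n+[m/n]*n; m%n<n; m/n*n≡m)
open import Data.Nat.Divisibility as ℕ∣ using (_∣_; divides)
open import Data.Nat.Coprimality as Coprime using (Coprime)
open import Data.Nat.GCD using (gcd; module Bézout; gcd[m,n]∣m; gcd[m,n]∣n; gcd[m,n]≡0⇒m≡0)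
open import Data.Nat.LCM using (lcm; m∣lcm[m,n]; n∣lcm[m,n]; lcm-least; gcd*lcm)
open import Data.Integer as ℤ using (ℤ; +_; -_; _-_)
import Data.Integer.Properties as ℤ
open import Data.Integer.Divisibility.Signed as ℤ∣ using () renaming (_∣_ to _∣ℤ_)
import Data.Integer.Tactic.RingSolver as ℤ-Solver
import Data.Nat.Tactic.RingSolver as ℕ-Solver
open import Data.Product using (Σ; _,_)
open import Data.Sum using (inj₁; inj₂)
open import Data.Empty using (⊥-elim)
open import Function using (_∘_)
open import Data.Fin as Fin using (Fin; toℕ; fromℕ<)
import Data.Fin.Properties as FinP
open import Data.Fin.Properties using (any?)
open import Data.Nat.Induction using (<-wellFounded)
open import Induction.WellFounded using (Acc; acc)
open import Relation.Nullary.Decidable using (_×-dec_)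
open import Relation.Nullary using (¬_; Dec; yes; no)
open import Relation.Binary.Definitions using (tri<; tri≈; tri>)
open import Relation.Binary.PropositionalEquality
open import Relation.Binary.Bundles using (Setoid)
import Relation.Binary.Reasoning.Setoid as SetoidReasoning

-- Congruence modulo m, in the same (signed) form as Defs' `_≡_[mod_]`, but
-- wrapped in a record so that a, b and m can be inferred from a proof.
record _≈_[mod_] (a b m : ℕ) : Set where
  constructor mkCong
  field m∣a-b : + m ∣ℤ (+ a - + b)
open _≈_[mod_]

infix 4 _≈_[mod_]

fromDefs : ∀ {m a b} → a ≡ b [mod m ] → a ≈ b [mod m ]
fromDefs p = mkCong (ℤ∣.∣ᵤ⇒∣ p)

toDefs : ∀ {m a b} → a ≈ b [mod m ] → a ≡ b [mod m ]
toDefs p = ℤ∣.∣⇒∣ᵤ (m∣a-b p)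

by-difference : ∀ {m a b} {d : ℤ} → d ≡ + a - + b → + m ∣ℤ d → a ≈ b [mod m ]
by-difference eq m∣d = mkCong (subst (_ ∣ℤ_) eq m∣d)

≈-refl : ∀ {m a} → a ≈ a [mod m ]
≈-refl {a = a} = mkCong (ℤ∣.divides (+ 0) (ℤ.+-inverseʳ (+ a)))

≈-reflexive : ∀ {m a b} → a ≡ b → a ≈ b [mod m ]
≈-reflexive refl = ≈-refl

≈-sym : ∀ {m a b} → a ≈ b [mod m ] → b ≈ a [mod m ]
≈-sym {a = a} {b} (mkCong p) = by-difference (negate (+ a) (+ b)) (ℤ∣.∣m⇒∣-m p)
  where negate : ∀ x y → - (x - y) ≡ y - x
        negate = ℤ-Solver.solve-∀

≈-trans : ∀ {m a b c} → a ≈ b [mod m ] → b ≈ c [mod m ] → a ≈ c [mod m ]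
≈-trans {a = a} {b} {c} (mkCong p) (mkCong q) =
  by-difference (telescope (+ a) (+ b) (+ c)) (ℤ∣.∣m∣n⇒∣m+n p q)
  where telescope : ∀ x y z → (x - y) ℤ.+ (y - z) ≡ x - z
        telescope = ℤ-Solver.solve-∀

≈-+ : ∀ {m a b c d} → a ≈ b [mod m ] → c ≈ d [mod m ] → a + c ≈ b + d [mod m ]
≈-+ {a = a} {b} {c} {d} (mkCong p) (mkCong q) = by-difference eq (ℤ∣.∣m∣n⇒∣m+n p q)
  where
  regroup : ∀ x y z w → (x - y) ℤ.+ (z - w) ≡ (x ℤ.+ z) - (y ℤ.+ w)
  regroup = ℤ-Solver.solve-∀
  eq : (+ a - + b) ℤ.+ (+ c - + d) ≡ + (a + c) - + (b + d)
  eq = trans (regroup (+ a) (+ b) (+ c) (+ d))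
             (sym (cong₂ _-_ (ℤ.pos-+ a c) (ℤ.pos-+ b d)))

≈-* : ∀ {m a b c d} → a ≈ b [mod m ] → c ≈ d [mod m ] → a * c ≈ b * d [mod m ]
≈-* {a = a} {b} {c} {d} (mkCong p) (mkCong q) =
  by-difference eq (ℤ∣.∣m∣n⇒∣m+n (ℤ∣.∣m⇒∣m*n (+ c) p) (ℤ∣.∣n⇒∣m*n (+ b) q))
  where
  regroup : ∀ x y z w → (x - y) ℤ.* z ℤ.+ y ℤ.* (z - w) ≡ x ℤ.* z - y ℤ.* w
  regroup = ℤ-Solver.solve-∀
  eq : (+ a - + b) ℤ.* + c ℤ.+ + b ℤ.* (+ c - + d) ≡ + (a * c) - + (b * d)
  eq = trans (regroup (+ a) (+ b) (+ c) (+ d))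
             (sym (cong₂ _-_ (ℤ.pos-* a c) (ℤ.pos-* b d)))

≈-^ : ∀ {m a b} n → a ≈ b [mod m ] → a ^ n ≈ b ^ n [mod m ]
≈-^ zero    p = ≈-refl
≈-^ (suc n) p = ≈-* p (≈-^ n p)

≈-*ˡ : ∀ {m a b} c → a ≈ b [mod m ] → c * a ≈ c * b [mod m ]
≈-*ˡ c = ≈-* (≈-refl {a = c})

≈-setoid : ℕ → Setoid _ _
≈-setoid m = record
  { Carrier = ℕ
  ; _≈_ = _≈_[mod m ]
  ; isEquivalence = record { refl = ≈-refl ; sym = ≈-sym ; trans = ≈-trans }
  }

module ≈-Reasoning (m : ℕ) = SetoidReasoning (≈-setoid m)

∣⇒≈0 : ∀ {m a} → m ∣ a → a ≈ 0 [mod m ]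
∣⇒≈0 {m} (divides k refl) =
  by-difference (trans (sym (ℤ.pos-* k m)) (sym (ℤ.+-identityʳ _))) (ℤ∣.∣n⇒∣m*n (+ k) ℤ∣.∣-refl)

≈-% : ∀ {m} a .{{_ : NonZero m}} → a ≈ a % m [mod m ]
≈-% {m} a = subst (_≈ a % m [mod m ]) (sym (m≡m%n+[m/n]*n a m))
  (subst (a % m + (a / m) * m ≈_[mod m ]) (+-identityʳ _)
    (≈-+ ≈-refl (∣⇒≈0 (ℕ∣.n∣m*n (a / m)))))

∣∧<⇒≡0 : ∀ {m k} → m ∣ k → k < m → k ≡ 0
∣∧<⇒≡0 {k = zero}  _   _   = refl
∣∧<⇒≡0 {k = suc k} m∣k k<m = ⊥-elim (<⇒≱ k<m (ℕ∣.∣⇒≤ m∣k))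

≈⇒≡ : ∀ {m a b} → a < m → b < m → a ≈ b [mod m ] → a ≡ b
≈⇒≡ {m} {a} {b} a<m b<m p =
  ℤ.+-injective (ℤ.i-j≡0⇒i≡j (+ a) (+ b) (ℤ.∣i∣≡0⇒i≡0 (∣∧<⇒≡0 (toDefs p) dist<m)))
  where
  dist<m : ℤ.∣ + a - + b ∣ < m
  dist<m = ≤-<-trans (subst (_≤ a ℕ.⊔ b) (cong ℤ.∣_∣ (sym (ℤ.m-n≡m⊖n a b))) (ℤ.∣m⊝n∣≤m⊔n a b))
                     (⊔-lub a<m b<m)

coprime-1ʳ : ∀ {a} → Coprime a 1
coprime-1ʳ {a} = Coprime.sym (Coprime.1-coprimeTo a)

coprime-∣ʳ : ∀ {a c d} → Coprime a c → d ∣ c → Coprime a d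
coprime-∣ʳ a⊥c d∣c (t∣a , t∣d) = a⊥c (t∣a , ℕ∣.∣-trans t∣d d∣c)

coprime-*ˡ : ∀ {a b c} → Coprime a c → Coprime b c → Coprime (a * b) c
coprime-*ˡ a⊥c b⊥c {t} (t∣ab , t∣c) =
  b⊥c (Coprime.coprime-divisor (Coprime.sym (coprime-∣ʳ a⊥c t∣c)) t∣ab , t∣c)

coprime-*ʳ : ∀ {a b c} → Coprime a b → Coprime a c → Coprime a (b * c)
coprime-*ʳ a⊥b a⊥c = Coprime.sym (coprime-*ˡ (Coprime.sym a⊥b) (Coprime.sym a⊥c))

coprime-^ˡ : ∀ {a c} n → Coprime a c → Coprime (a ^ n) c
coprime-^ˡ zero    a⊥c = Coprime.1-coprimeTo _
coprime-^ˡ (suc n) a⊥c = coprime-*ˡ a⊥c (coprime-^ˡ n a⊥c)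

coprime-^ʳ : ∀ {a c} n → Coprime a c → Coprime a (c ^ n)
coprime-^ʳ n a⊥c = Coprime.sym (coprime-^ˡ n (Coprime.sym a⊥c))

coprime-∣-* : ∀ {q n k} → Coprime q n → q ∣ k → n ∣ k → q * n ∣ k
coprime-∣-* {q} {n} q⊥n (divides t refl) n∣tq =
  subst (q * n ∣_) (*-comm q t)
    (ℕ∣.*-monoʳ-∣ q (Coprime.coprime-divisor (Coprime.sym q⊥n) (subst (n ∣_) (*-comm t q) n∣tq)))

prime∤⇒coprime : ∀ {p y} → Prime p → ¬ p ∣ y → Coprime y p
prime∤⇒coprime pp p∤y {t} (t∣y , t∣p) with prime⇒irreducible pp t∣p
... | inj₁ t≡1 = t≡1
... | inj₂ refl = ⊥-elim (p∤y t∣y)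

distinct-primes-coprime : ∀ {p p′} → Prime p → Prime p′ → p ≢ p′ → Coprime p p′
distinct-primes-coprime pp pp′ p≢p′ (t∣p , t∣p′) with prime⇒irreducible pp t∣p
... | inj₁ t≡1 = t≡1
... | inj₂ refl with prime⇒irreducible pp′ t∣p′
...   | inj₁ p≡1 = ⊥-elim (ℕ.nonTrivial⇒≢1 {{prime⇒nonTrivial pp}} p≡1)
...   | inj₂ p≡p′ = ⊥-elim (p≢p′ p≡p′)

≈-mod-∣ : ∀ {d m a b} → d ∣ m → a ≈ b [mod m ] → a ≈ b [mod d ]
≈-mod-∣ {d} {m} d∣m (mkCong p) = mkCong (ℤ∣.∣-trans (ℤ∣.∣ᵤ⇒∣ {+ d} {+ m} d∣m) p)

≈-mod-* : ∀ {q n a b} → Coprime q n → a ≈ b [mod q ] → a ≈ b [mod n ] → a ≈ b [mod q * n ]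
≈-mod-* q⊥n p r = fromDefs (coprime-∣-* q⊥n (toDefs p) (toDefs r))

≈-cancelˡ : ∀ {m c a b} → Coprime c m → c * a ≈ c * b [mod m ] → a ≈ b [mod m ]
≈-cancelˡ {m} {c} {a} {b} c⊥m p =
  fromDefs (Coprime.coprime-divisor (Coprime.sym c⊥m) (subst (m ∣_) dist (toDefs p)))
  where
  factor : ∀ x u v → x ℤ.* u - x ℤ.* v ≡ x ℤ.* (u - v)
  factor = ℤ-Solver.solve-∀
  open ≡-Reasoning
  dist : ℤ.∣ + (c * a) - + (c * b) ∣ ≡ c * ℤ.∣ + a - + b ∣
  dist = begin
    ℤ.∣ + (c * a) - + (c * b) ∣        ≡⟨ cong ℤ.∣_∣ (cong₂ _-_ (ℤ.pos-* c a) (ℤ.pos-* c b)) ⟩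
    ℤ.∣ + c ℤ.* + a - + c ℤ.* + b ∣    ≡⟨ cong ℤ.∣_∣ (factor (+ c) (+ a) (+ b)) ⟩
    ℤ.∣ + c ℤ.* (+ a - + b) ∣          ≡⟨ ℤ.abs-* (+ c) (+ a - + b) ⟩
    c * ℤ.∣ + a - + b ∣                ∎

-- Congruence is decidable, so least periods and orders can be searched for.
infix 4 _≈?_[mod_]

_≈?_[mod_] : ∀ a b m → Dec (a ≈ b [mod m ])
a ≈? b [mod m ] with + m ℤ∣.∣? (+ a - + b)
... | yes p = yes (mkCong p)
... | no ¬p = no (λ q → ¬p (m∣a-b q))

Least : (ℕ → Set) → ℕ → Set
Least P k = 1 ≤ k × P k × (∀ j → 1 ≤ j → j < k → ¬ P j)

-- A decidable set with a positive element has a least positive element: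
-- descend to a smaller positive element as long as there is one.
least-exists : ∀ {P : ℕ → Set} → (∀ n → Dec (P n)) → ∀ {n} → 1 ≤ n → P n → Σ ℕ (Least P)
least-exists {P} P? {n} = descend n (<-wellFounded n)
  where
  descend : ∀ n → Acc _<_ n → 1 ≤ n → P n → Σ ℕ (Least P)
  descend n (acc smaller) n≥1 pn with any? (λ (j : Fin n) → (1 ≤? toℕ j) ×-dec P? (toℕ j))
  ... | yes (j , j≥1 , pj) = descend (toℕ j) (smaller (FinP.toℕ<n j)) j≥1 pj
  ... | no none = n , n≥1 , pn , λ j j≥1 j<n pj →
    none (fromℕ< j<n , subst (λ i → 1 ≤ i × P i) (sym (FinP.toℕ-fromℕ< j<n)) (j≥1 , pj))

-- Sets of naturals containing 0 and closed under addition and subtraction,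
-- i.e. the nonnegative parts of subgroups of ℤ; periods and exponents with
-- power 1 both form such sets.
record AdditivelyClosed (P : ℕ → Set) : Set where
  field
    has-zero : P 0
    closed-+ : ∀ {a b} → P a → P b → P (a + b)
    closed-∸ : ∀ {a b} → P (a + b) → P a → P b

module _ {P : ℕ → Set} (closed : AdditivelyClosed P) where
  open AdditivelyClosed closed

  multiples : ∀ {k} → P k → ∀ c → P (c * k)
  multiples pk zero    = has-zero
  multiples pk (suc c) = closed-+ pk (multiples pk c)

  -- The least positive element divides every element: the remainder of
  -- division by it lies in P and is smaller.
  least-divides : ∀ {k n} → Least P k → P n → k ∣ n
  least-divides {k} {n} (k≥1 , pk , below) pn = ℕ∣.m%n≡0⇒n∣m n k {{nz}} remainder≡0
    where
    instance nz : NonZero k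
    nz = ℕ.>-nonZero k≥1
    p-rem : P (n % k)
    p-rem = closed-∸ (subst P (trans (m≡m%n+[m/n]*n n k) (+-comm (n % k) _)) pn)
                     (multiples pk (n / k))
    remainder≡0 : n % k ≡ 0
    remainder≡0 with n % k in eq
    ... | zero  = refl
    ... | suc r = ⊥-elim (below (suc r) (s≤s z≤n) (subst (_< k) eq (m%n<n n k)) (subst P eq p-rem))

Periodic : ℕ → ℕ → ℕ → Set
Periodic m y n = y ^ (2 ^ n) ≈ y [mod m ]

MinimalPeriod : ℕ → ℕ → ℕ → Set
MinimalPeriod m y = Least (Periodic m y)

PowerIsOne : ℕ → ℕ → ℕ → Set
PowerIsOne m y n = y ^ n ≈ 1 [mod m ]

Order : ℕ → ℕ → ℕ → Set
Order m y = Least (PowerIsOne m y)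

square-iterate : ∀ y a b → y ^ (2 ^ (a + b)) ≡ (y ^ (2 ^ a)) ^ (2 ^ b)
square-iterate y a b = trans (cong (y ^_) (^-distribˡ-+-* 2 a b)) (sym (^-*-assoc y (2 ^ a) (2 ^ b)))

square-once : ∀ y i → (y ^ (2 ^ i)) ^ 2 ≡ y ^ (2 ^ suc i)
square-once y i = trans (sym (square-iterate y i 1)) (cong (λ t → y ^ (2 ^ t)) (+-comm i 1))

module _ {m y : ℕ} where

  periodic-closed : AdditivelyClosed (Periodic m y)
  periodic-closed = record
    { has-zero = ≈-reflexive (^-identityʳ y)
    ; closed-+ = λ {a} {b} pa pb →
        subst (_≈ y [mod m ]) (sym (square-iterate y a b)) (≈-trans (≈-^ (2 ^ b) pa) pb)
    ; closed-∸ = λ {a} {b} pab pa →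
        ≈-trans (≈-sym (≈-^ (2 ^ b) pa)) (subst (_≈ y [mod m ]) (square-iterate y a b) pab)
    }

  powerIsOne-closed : AdditivelyClosed (PowerIsOne m y)
  powerIsOne-closed = record
    { has-zero = ≈-refl
    ; closed-+ = λ {a} {b} pa pb →
        subst (_≈ 1 [mod m ]) (sym (^-distribˡ-+-* y a b)) (≈-* pa pb)
    ; closed-∸ = λ {a} {b} pab pa →
        ≈-trans (≈-reflexive (sym (*-identityˡ (y ^ b))))
          (≈-trans (≈-* (≈-sym pa) (≈-refl {a = y ^ b}))
                   (subst (_≈ 1 [mod m ]) (^-distribˡ-+-* y a b) pab))
    }

  minimalPeriod-exists : ∀ {n} → 1 ≤ n → Periodic m y n → Σ ℕ (MinimalPeriod m y)
  minimalPeriod-exists = least-exists (λ n → y ^ (2 ^ n) ≈? y [mod m ])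

  order-exists : ∀ {n} → 1 ≤ n → PowerIsOne m y n → Σ ℕ (Order m y)
  order-exists = least-exists (λ n → y ^ n ≈? 1 [mod m ])

periodic-≈ : ∀ {m y y′ n} → y ≈ y′ [mod m ] → Periodic m y n → Periodic m y′ n
periodic-≈ {n = n} y≈y′ p = ≈-trans (≈-sym (≈-^ (2 ^ n) y≈y′)) (≈-trans p y≈y′)

minimalPeriod-≈ : ∀ {m y y′ k} → y ≈ y′ [mod m ] → MinimalPeriod m y k → MinimalPeriod m y′ k
minimalPeriod-≈ {k = k} y≈y′ (k≥1 , pk , below) =
  k≥1 , periodic-≈ {n = k} y≈y′ pk ,
  λ j j≥1 j<k pj → below j j≥1 j<k (periodic-≈ {n = j} (≈-sym y≈y′) pj)

-- A cycle x of length k is the orbit of its first entry, so x₀ has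
-- minimal period k (distinctness of the entries gives minimality).
cycle⇒minimalPeriod : ∀ {m k x} → IsCycle m k x → Σ ℕ λ y → MinimalPeriod m y k
cycle⇒minimalPeriod {k = zero} c = ⊥-elim (<⇒≱ (IsCycle.length-pos c) z≤n)
cycle⇒minimalPeriod {m} {suc k} {x} c = x₀ , s≤s z≤n , wraps-around , minimal
  where
  open IsCycle c
  x₀ = x Fin.zero
  orbit : ∀ j (j<k : j < suc k) → x₀ ^ (2 ^ j) ≈ x (fromℕ< j<k) [mod m ]
  orbit zero    _    = ≈-reflexive (^-identityʳ x₀)
  orbit (suc j) j<k  = subst (_≈ x (fromℕ< j<k) [mod m ]) (square-once x₀ j)
    (≈-trans (≈-^ 2 (orbit j j<k′)) (fromDefs (squaring _ _ (inj₁ successor))))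
    where
    j<k′ = <-trans (n<1+n j) j<k
    successor : toℕ (fromℕ< j<k) ≡ suc (toℕ (fromℕ< j<k′))
    successor = trans (FinP.toℕ-fromℕ< j<k) (cong suc (sym (FinP.toℕ-fromℕ< j<k′)))
  wraps-around : Periodic m x₀ (suc k)
  wraps-around = subst (_≈ x₀ [mod m ]) (square-once x₀ k)
    (≈-trans (≈-^ 2 (orbit k (n<1+n k)))
             (fromDefs (squaring _ _ (inj₂ (cong suc (FinP.toℕ-fromℕ< (n<1+n k)) , refl)))))
  minimal : ∀ j → 1 ≤ j → j < suc k → ¬ Periodic m x₀ j
  minimal j j≥1 j<k pj = <⇒≢ j≥1 (sym (trans (sym (FinP.toℕ-fromℕ< j<k)) (cong toℕ same-index)))
    where
    same-index : fromℕ< j<k ≡ Fin.zero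
    same-index = distinct (≈⇒≡ (residue _) (residue _) (≈-trans (≈-sym (orbit j j<k)) pj))

minimalPeriod⇒cycle : ∀ {m y k} .{{_ : NonZero m}} → MinimalPeriod m y k →
                      IsCycle m k (λ i → (y ^ (2 ^ toℕ i)) % m)
minimalPeriod⇒cycle {m} {y} {k} (k≥1 , pk , below) = record
  { length-pos = k≥1
  ; residue    = λ i → m%n<n _ m
  ; distinct   = distinct
  ; squaring   = λ i j i→j → toDefs (≈-trans (≈-^ 2 (entry i))
                   (subst (_≈ x j [mod m ]) (sym (square-once y (toℕ i))) (next i→j)))
  }
  where
  x : Fin k → ℕ
  x i = (y ^ (2 ^ toℕ i)) % m
  entry : ∀ i → x i ≈ y ^ (2 ^ toℕ i) [mod m ]
  entry i = ≈-sym (≈-% _)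
  next : ∀ {i j} → CycSucc i j → y ^ (2 ^ suc (toℕ i)) ≈ x j [mod m ]
  next {i} {j} (inj₁ j≡i+1) = subst (λ t → y ^ (2 ^ t) ≈ x j [mod m ]) j≡i+1 (≈-sym (entry j))
  next {i} {j} (inj₂ (i+1≡k , j≡0)) = subst (λ t → y ^ (2 ^ t) ≈ x j [mod m ]) (sym i+1≡k)
    (≈-trans pk (≈-trans (≈-reflexive (sym (^-identityʳ y)))
      (subst (λ t → y ^ (2 ^ t) ≈ x j [mod m ]) j≡0 (≈-sym (entry j)))))
  -- y ^ 2 ^ i ≡ y ^ 2 ^ j with i < j < k would give y the period i + (k - j) < k
  no-collision : ∀ i j → i < j → j < k → ¬ y ^ (2 ^ i) ≈ y ^ (2 ^ j) [mod m ]
  no-collision i j i<j j<k collide = below (i + t) (≤-trans t≥1 (m≤n+m t i)) shorter period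
    where
    t = k ∸ j
    t≥1 : 1 ≤ t
    t≥1 = m<n⇒0<n∸m j<k
    j+t≡k : j + t ≡ k
    j+t≡k = m+[n∸m]≡n (<⇒≤ j<k)
    shorter : i + t < k
    shorter = subst (i + t <_) j+t≡k (+-monoˡ-< t i<j)
    period : Periodic m y (i + t)
    period = subst (_≈ y [mod m ]) (sym (square-iterate y i t))
      (≈-trans (≈-^ (2 ^ t) collide)
        (subst (_≈ y [mod m ]) (square-iterate y j t)
          (subst (λ u → y ^ (2 ^ u) ≈ y [mod m ]) (sym j+t≡k) pk)))
  distinct : ∀ {i j} → x i ≡ x j → i ≡ j
  distinct {i} {j} xi≡xj with <-cmp (toℕ i) (toℕ j)
  ... | tri< i<j _ _ = ⊥-elim (no-collision _ _ i<j (FinP.toℕ<n j)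
          (≈-trans (≈-sym (entry i)) (≈-trans (≈-reflexive xi≡xj) (entry j))))
  ... | tri≈ _ i≡j _ = FinP.toℕ-injective i≡j
  ... | tri> _ _ j<i = ⊥-elim (no-collision _ _ j<i (FinP.toℕ<n i)
          (≈-trans (≈-sym (entry j)) (≈-trans (≈-reflexive (sym xi≡xj)) (entry i))))

record Idempotents (q n : ℕ) : Set where
  field
    e₁ e₂ : ℕ
    e₁≈1  : e₁ ≈ 1 [mod q ]
    e₁≈0  : e₁ ≈ 0 [mod n ]
    e₂≈0  : e₂ ≈ 0 [mod q ]
    e₂≈1  : e₂ ≈ 1 [mod n ]

swap-idempotents : ∀ {q n} → Idempotents q n → Idempotents n q
swap-idempotents e = record
  { e₁ = e₂ ; e₂ = e₁ ; e₁≈1 = e₂≈1 ; e₁≈0 = e₂≈0 ; e₂≈0 = e₁≈0 ; e₂≈1 = e₁≈1 }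
  where open Idempotents e

-- From a Bézout relation 1 + T = U with n ∣ T and q ∣ U: U is 0 modulo q and
-- 1 modulo n, while T ≡ -1 modulo q, so T² is 1 modulo q and 0 modulo n.
bézout⇒idempotents : ∀ {q n T U} → 1 + T ≡ U → n ∣ T → q ∣ U → Idempotents q n
bézout⇒idempotents {q} {n} {T} {U} 1+T≡U n∣T q∣U = record
  { e₁ = T * T ; e₂ = U
  ; e₁≈1 = T²≈1
  ; e₁≈0 = subst (T * T ≈_[mod n ]) (*-zeroʳ T) (≈-*ˡ T T≈0)
  ; e₂≈0 = U≈0
  ; e₂≈1 = subst (_≈ 1 [mod n ]) 1+T≡U
             (subst (1 + T ≈_[mod n ]) (+-identityʳ 1) (≈-+ ≈-refl T≈0))
  }
  where
  T≈0 = ∣⇒≈0 n∣T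
  U≈0 = ∣⇒≈0 q∣U
  expand : ∀ t → t * t + (1 + t) ≡ t * (1 + t) + 1
  expand = ℕ-Solver.solve-∀
  T²≈1 : T * T ≈ 1 [mod q ]
  T²≈1 = begin
    T * T            ≡⟨ +-identityʳ (T * T) ⟨
    T * T + 0        ≈⟨ ≈-+ ≈-refl (≈-sym U≈0) ⟩
    T * T + U        ≡⟨ cong (λ u → T * T + u) 1+T≡U ⟨
    T * T + (1 + T)  ≡⟨ expand T ⟩
    T * (1 + T) + 1  ≡⟨ cong (λ u → T * u + 1) 1+T≡U ⟩
    T * U + 1        ≈⟨ ≈-+ (≈-*ˡ T U≈0) ≈-refl ⟩
    T * 0 + 1        ≡⟨ cong (_+ 1) (*-zeroʳ T) ⟩
    1                ∎
    where open ≈-Reasoning q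

coprime⇒idempotents : ∀ {q n} → Coprime q n → Idempotents q n
coprime⇒idempotents q⊥n with Coprime.coprime-Bézout q⊥n
... | Bézout.+- x y eq = bézout⇒idempotents eq (ℕ∣.n∣m*n y) (ℕ∣.n∣m*n x)
... | Bézout.-+ x y eq = swap-idempotents (bézout⇒idempotents eq (ℕ∣.n∣m*n x) (ℕ∣.n∣m*n y))

crt : ∀ {q n} → Coprime q n → ∀ a b → Σ ℕ λ y → y ≈ a [mod q ] × y ≈ b [mod n ]
crt {q} {n} q⊥n a b =
  a * e₁ + b * e₂ ,
  ≈-trans (≈-+ (≈-*ˡ a e₁≈1) (≈-*ˡ b e₂≈0)) (≈-reflexive (first a b)) ,
  ≈-trans (≈-+ (≈-*ˡ a e₁≈0) (≈-*ˡ b e₂≈1)) (≈-reflexive (second a b))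
  where
  open Idempotents (coprime⇒idempotents q⊥n)
  first : ∀ a b → a * 1 + b * 0 ≡ a
  first = ℕ-Solver.solve-∀
  second : ∀ a b → a * 0 + b * 1 ≡ b
  second = ℕ-Solver.solve-∀

-- L is the period exponent modulo n: some element has minimal period L,
-- and every minimal period divides L (the analogue of the exponent of a
-- group, i.e. the lcm of all element orders, when it is attained).
PeriodExponent : ℕ → ℕ → Set
PeriodExponent n L = (Σ ℕ λ y → MinimalPeriod n y L) × (∀ y k → MinimalPeriod n y k → k ∣ L)

-- Since divisors are bounded, the period exponent is the maximal cycle length.
exponent⇒IsL : ∀ {n L} .{{_ : NonZero n}} → PeriodExponent n L → IsL n L
exponent⇒IsL {n} {L} ((y , minimal) , divides-L) = (_ , minimalPeriod⇒cycle minimal) , maximal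
  where
  maximal : ∀ k (x : Fin k → ℕ) → IsCycle n k x → k ≤ L
  maximal k x c with cycle⇒minimalPeriod c
  ... | y′ , minimal′ = ℕ∣.∣⇒≤ {{ℕ.>-nonZero (proj₁ minimal)}} (divides-L y′ k minimal′)

IsL⇒attained : ∀ {n L} → IsL n L → Σ ℕ λ y → MinimalPeriod n y L
IsL⇒attained ((_ , c) , _) = cycle⇒minimalPeriod c

IsL-maximal : ∀ {n L y k} .{{_ : NonZero n}} → IsL n L → MinimalPeriod n y k → k ≤ L
IsL-maximal (_ , maximal) minimal = maximal _ _ (minimalPeriod⇒cycle minimal)

exponent-one : PeriodExponent 1 1
exponent-one = (0 , ≤-refl , mod-one , λ j j≥1 j<1 _ → <⇒≱ j<1 j≥1) ,
               λ y k minimal → least-divides periodic-closed minimal mod-one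
  where
  mod-one : ∀ {a b} → a ≈ b [mod 1 ]
  mod-one = fromDefs (ℕ∣.1∣ _)

periodic-multiple : ∀ {m y k N} → Periodic m y k → k ∣ N → Periodic m y N
periodic-multiple pk (divides c refl) = multiples periodic-closed pk c

lcm-positive : ∀ {a b} → 1 ≤ a → 1 ≤ b → 1 ≤ lcm a b
lcm-positive {a} {b} a≥1 b≥1 = n≢0⇒n>0 λ lcm≡0 → <⇒≢ (*-mono-≤ a≥1 b≥1) (sym (begin
  a * b               ≡⟨ gcd*lcm a b ⟨
  gcd a b * lcm a b   ≡⟨ cong (gcd a b *_) lcm≡0 ⟩
  gcd a b * 0         ≡⟨ *-zeroʳ (gcd a b) ⟩
  0                   ∎))
  where open ≡-Reasoning

-- Modulo q * n with q, n coprime, a period is a common period modulo q and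
-- modulo n, so the minimal period is the lcm of the two minimal periods.
minimalPeriod-lcm : ∀ {q n y l l′} → Coprime q n →
                    MinimalPeriod q y l → MinimalPeriod n y l′ → MinimalPeriod (q * n) y (lcm l l′)
minimalPeriod-lcm {q} {n} {y} {l} {l′} q⊥n mp mp′ =
  lcm-positive (proj₁ mp) (proj₁ mp′) ,
  ≈-mod-* q⊥n (periodic-multiple (proj₁ (proj₂ mp)) (m∣lcm[m,n] l l′))
              (periodic-multiple (proj₁ (proj₂ mp′)) (n∣lcm[m,n] l l′)) ,
  minimal
  where
  minimal : ∀ j → 1 ≤ j → j < lcm l l′ → ¬ Periodic (q * n) y j
  minimal j j≥1 j<lcm pj = <⇒≱ j<lcm (ℕ∣.∣⇒≤ {{ℕ.>-nonZero j≥1}} (lcm-least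
    (least-divides periodic-closed mp  (≈-mod-∣ (ℕ∣.m∣m*n n) pj))
    (least-divides periodic-closed mp′ (≈-mod-∣ (ℕ∣.n∣m*n q) pj))))

periodic⇒exponent : ∀ {q L z k} → PeriodExponent q L → 1 ≤ k → Periodic q z k → Periodic q z L
periodic⇒exponent {z = z} (_ , divides-L) k≥1 pk with minimalPeriod-exists k≥1 pk
... | k₀ , minimal = periodic-multiple (proj₁ (proj₂ minimal)) (divides-L z k₀ minimal)

-- Period exponents of coprime moduli combine to their lcm: the CRT lift of
-- elements attaining l and l′ attains lcm l l′, and every element modulo
-- q * n is periodic with period l modulo q and l′ modulo n.
exponent-* : ∀ {q n l l′} → Coprime q n → PeriodExponent q l → PeriodExponent n l′ →
             PeriodExponent (q * n) (lcm l l′)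
exponent-* {q} {n} {l} {l′} q⊥n e@((y₁ , mp₁) , _) e′@((y₂ , mp₂) , _) =
  (y , minimalPeriod-lcm q⊥n (minimalPeriod-≈ (≈-sym y≈y₁) mp₁) (minimalPeriod-≈ (≈-sym y≈y₂) mp₂)) ,
  divides-lcm
  where
  solution = crt q⊥n y₁ y₂
  y = proj₁ solution
  y≈y₁ = proj₁ (proj₂ solution)
  y≈y₂ = proj₂ (proj₂ solution)
  divides-lcm : ∀ z k → MinimalPeriod (q * n) z k → k ∣ lcm l l′
  divides-lcm z k minimal@(k≥1 , pk , _) = least-divides periodic-closed minimal (≈-mod-* q⊥n
    (periodic-multiple (periodic⇒exponent e  k≥1 (≈-mod-∣ (ℕ∣.m∣m*n n) pk)) (m∣lcm[m,n] l l′))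
    (periodic-multiple (periodic⇒exponent e′ k≥1 (≈-mod-∣ (ℕ∣.n∣m*n q) pk)) (n∣lcm[m,n] l l′)))

-- n = A * B where B is coprime to k and A only has prime factors of k
-- (anything coprime to k is coprime to A).
record Separation (n k : ℕ) : Set where
  field
    A B         : ℕ
    n≡A*B       : n ≡ A * B
    B⊥k         : Coprime B k
    A-supported : ∀ {x} → Coprime x k → Coprime x A

-- Repeatedly move gcd n k from n into A.
separate : ∀ n k → 1 ≤ n → Separation n k
separate n k = go n (<-wellFounded n)
  where
  go : ∀ n → Acc _<_ n → 1 ≤ n → Separation n k
  go n (acc smaller) n≥1 with gcd n k ≟ 1
  ... | yes g≡1 = record
    { A = 1 ; B = n ; n≡A*B = sym (*-identityˡ n) ; B⊥k = Coprime.gcd≡1⇒coprime g≡1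
    ; A-supported = λ _ → coprime-1ʳ }
  ... | no g≢1 = record
    { A = g * A ; B = B ; B⊥k = B⊥k
    ; n≡A*B = trans n≡n′*g (trans (cong (_* g) n′≡A*B) (regroup A B g))
    ; A-supported = λ x⊥k → coprime-*ʳ (coprime-∣ʳ x⊥k (gcd[m,n]∣n n k)) (A-supported x⊥k) }
    where
    g = gcd n k
    instance g≢0 : NonZero g
    g≢0 = ℕ.≢-nonZero (λ g≡0 → <⇒≢ n≥1 (sym (gcd[m,n]≡0⇒m≡0 g≡0)))
    n′ = n / g
    n≡n′*g : n ≡ n′ * g
    n≡n′*g = sym (m/n*n≡m (gcd[m,n]∣m n k))
    n′≥1 : 1 ≤ n′
    n′≥1 = n≢0⇒n>0 (λ n′≡0 → <⇒≢ n≥1 (sym (trans n≡n′*g (cong (_* g) n′≡0))))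
    g>1 : 1 < g
    g>1 = ≤∧≢⇒< (n≢0⇒n>0 (ℕ.≢-nonZero⁻¹ g)) (g≢1 ∘ sym)
    n′<n : n′ < n
    n′<n = subst (n′ <_) (sym n≡n′*g) (m<m*n n′ g {{ℕ.>-nonZero n′≥1}} g>1)
    open Separation (go n′ (smaller n′<n) n′≥1) renaming (n≡A*B to n′≡A*B)
    regroup : ∀ a b c → (a * b) * c ≡ (c * a) * b
    regroup = ℕ-Solver.solve-∀

record CoprimeCover (d e : ℕ) : Set where
  field
    d′ e′   : ℕ
    d′∣d    : d′ ∣ d
    e′∣e    : e′ ∣ e
    d′⊥e′   : Coprime d′ e′
    d∣d′*e′ : d ∣ d′ * e′
    e∣d′*e′ : e ∣ d′ * e′

-- With g = gcd d e, d = d₁ g and e = e₁ g where d₁ ⊥ e₁.  Separating g = A B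
-- with respect to d₁ gives the cover d′ = d₁ A, e′ = e₁ B.
coprime-cover : ∀ d e → 1 ≤ d → CoprimeCover d e
coprime-cover d e d≥1 = record
  { d′ = d₁ * A ; e′ = e₁ * B
  ; d′∣d = divides B (trans d≡d₁*g (trans (cong (d₁ *_) g≡A*B) (move-B d₁ A B)))
  ; e′∣e = divides A (trans e≡e₁*g (trans (cong (e₁ *_) g≡A*B) (move-A e₁ A B)))
  ; d′⊥e′ = coprime-*ˡ (coprime-*ʳ d₁⊥e₁ (Coprime.sym B⊥k))
                       (Coprime.sym (coprime-*ˡ (A-supported (Coprime.sym d₁⊥e₁)) (A-supported B⊥k)))
  ; d∣d′*e′ = divides e₁ (trans (regroup-d d₁ A e₁ B) (cong (e₁ *_) (sym d≡d₁*AB)))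
  ; e∣d′*e′ = divides d₁ (trans (regroup-e d₁ A e₁ B) (cong (d₁ *_) (sym e≡e₁*AB)))
  }
  where
  g = gcd d e
  instance g≢0 : NonZero g
  g≢0 = ℕ.≢-nonZero (λ g≡0 → <⇒≢ d≥1 (sym (gcd[m,n]≡0⇒m≡0 g≡0)))
  d₁ = d / g
  e₁ = e / g
  d≡d₁*g : d ≡ d₁ * g
  d≡d₁*g = sym (m/n*n≡m (gcd[m,n]∣m d e))
  e≡e₁*g : e ≡ e₁ * g
  e≡e₁*g = sym (m/n*n≡m (gcd[m,n]∣n d e))
  d₁⊥e₁ : Coprime d₁ e₁
  d₁⊥e₁ = Coprime.coprime-/gcd d e
  open Separation (separate g d₁ (n≢0⇒n>0 (ℕ.≢-nonZero⁻¹ g))) renaming (n≡A*B to g≡A*B)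
  d≡d₁*AB = trans d≡d₁*g (cong (d₁ *_) g≡A*B)
  e≡e₁*AB = trans e≡e₁*g (cong (e₁ *_) g≡A*B)
  move-B : ∀ x a b → x * (a * b) ≡ b * (x * a)
  move-B = ℕ-Solver.solve-∀
  move-A : ∀ x a b → x * (a * b) ≡ a * (x * b)
  move-A = ℕ-Solver.solve-∀
  regroup-d : ∀ x a y b → (x * a) * (y * b) ≡ y * (x * (a * b))
  regroup-d = ℕ-Solver.solve-∀
  regroup-e : ∀ x a y b → (x * a) * (y * b) ≡ x * (y * (a * b))
  regroup-e = ℕ-Solver.solve-∀

*-^ : ∀ a b n → (a * b) ^ n ≡ a ^ n * b ^ n
*-^ a b zero    = refl
*-^ a b (suc n) = trans (cong (a * b *_) (*-^ a b n)) (interchange a b (a ^ n) (b ^ n))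
  where interchange : ∀ a b c d → a * b * (c * d) ≡ a * c * (b * d)
        interchange = ℕ-Solver.solve-∀

^-comm : ∀ y u n → (y ^ u) ^ n ≡ (y ^ n) ^ u
^-comm y u n = trans (^-*-assoc y u n) (trans (cong (y ^_) (*-comm u n)) (sym (^-*-assoc y n u)))

powerIsOne-multiple : ∀ {q w d N} → PowerIsOne q w d → d ∣ N → PowerIsOne q w N
powerIsOne-multiple pd (divides c refl) = multiples powerIsOne-closed pd c

-- If the powers of y equal to 1 all have exponent divisible by d, z ^ e ≡ 1
-- and d ⊥ e, then (y z) ^ N ≡ 1 forces d ∣ N: raise to the power e.
product-exponent : ∀ {q y z d e N} → (∀ n → PowerIsOne q y n → d ∣ n) →
                   PowerIsOne q z e → Coprime d e → PowerIsOne q (y * z) N → d ∣ N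
product-exponent {q} {y} {z} {d} {e} {N} y-exponents ze≡1 d⊥e yzN≡1 =
  Coprime.coprime-divisor d⊥e (subst (d ∣_) (*-comm N e) (y-exponents (N * e) yNe≡1))
  where
  open ≈-Reasoning q
  yNe≡1 : y ^ (N * e) ≈ 1 [mod q ]
  yNe≡1 = begin
    y ^ (N * e)                    ≡⟨ *-identityʳ _ ⟨
    y ^ (N * e) * 1                ≈⟨ ≈-*ˡ (y ^ (N * e)) (≈-sym (powerIsOne-multiple ze≡1 (ℕ∣.n∣m*n N))) ⟩
    y ^ (N * e) * z ^ (N * e)      ≡⟨ *-^ y z (N * e) ⟨
    (y * z) ^ (N * e)              ≡⟨ ^-*-assoc (y * z) N e ⟨
    ((y * z) ^ N) ^ e              ≈⟨ ≈-^ e yzN≡1 ⟩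
    1 ^ e                          ≡⟨ ^-zeroˡ e ⟩
    1                              ∎

power-exponent : ∀ {q y u d N} → Order q y (u * d) → PowerIsOne q (y ^ u) N → d ∣ N
power-exponent {q} {y} {u} {d} {N} order@(ud≥1 , _) yuN≡1 =
  ℕ∣.*-cancelˡ-∣ u {{u≢0}} (least-divides powerIsOne-closed order
    (subst (_≈ 1 [mod q ]) (^-*-assoc y u N) yuN≡1))
  where
  u≢0 : NonZero u
  u≢0 = ℕ.≢-nonZero (λ u≡0 → <⇒≢ ud≥1 (sym (cong (_* d) u≡0)))

lcm-order : ∀ {q y z dy dz} → Order q y dy → Order q z dz →
            Σ ℕ λ u → Σ ℕ λ v → ∀ N → PowerIsOne q (y ^ u * z ^ v) N → dy ∣ N × dz ∣ N
lcm-order {q} {y} {z} {dy} {dz} y-order@(dy≥1 , ydy≡1 , _) z-order@(_ , zdz≡1 , _) =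
  u , v , λ N yz≡1 → let d′e′∣N = coprime-∣-* d′⊥e′ (d′∣N yz≡1) (e′∣N yz≡1) in
    ℕ∣.∣-trans d∣d′*e′ d′e′∣N , ℕ∣.∣-trans e∣d′*e′ d′e′∣N
  where
  open CoprimeCover (coprime-cover dy dz dy≥1)
  u = ℕ∣.quotient d′∣d
  v = ℕ∣.quotient e′∣e
  dy≡u*d′ : dy ≡ u * d′
  dy≡u*d′ = ℕ∣.m∣n⇒n≡quotient*m d′∣d
  dz≡v*e′ : dz ≡ v * e′
  dz≡v*e′ = ℕ∣.m∣n⇒n≡quotient*m e′∣e
  yu-order : ∀ n → PowerIsOne q (y ^ u) n → d′ ∣ n
  yu-order n = power-exponent {u = u} {d = d′} (subst (Order q y) dy≡u*d′ y-order)
  zv-order : ∀ n → PowerIsOne q (z ^ v) n → e′ ∣ n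
  zv-order n = power-exponent {u = v} {d = e′} (subst (Order q z) dz≡v*e′ z-order)
  yud′≡1 : PowerIsOne q (y ^ u) d′
  yud′≡1 = subst (_≈ 1 [mod q ]) (trans (cong (y ^_) dy≡u*d′) (sym (^-*-assoc y u d′))) ydy≡1
  zve′≡1 : PowerIsOne q (z ^ v) e′
  zve′≡1 = subst (_≈ 1 [mod q ]) (trans (cong (z ^_) dz≡v*e′) (sym (^-*-assoc z v e′))) zdz≡1
  d′∣N : ∀ {N} → PowerIsOne q (y ^ u * z ^ v) N → d′ ∣ N
  d′∣N = product-exponent yu-order zve′≡1 d′⊥e′
  e′∣N : ∀ {N} → PowerIsOne q (y ^ u * z ^ v) N → e′ ∣ N
  e′∣N {N} yz≡1 = product-exponent zv-order yud′≡1 (Coprime.sym d′⊥e′)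
    (subst (λ w → PowerIsOne q w N) (*-comm (y ^ u) (z ^ v)) yz≡1)

-- 2 ^ t = 1 + (2 ^ t - 1), splitting off one factor of w ^ (2 ^ t).
2^t≡1+[2^t∸1] : ∀ t → 2 ^ t ≡ suc (2 ^ t ∸ 1)
2^t≡1+[2^t∸1] t = trans (sym (m∸n+n≡m (m^n>0 2 t))) (+-comm _ 1)

2^t∸1≥1 : ∀ {t} → 1 ≤ t → 1 ≤ 2 ^ t ∸ 1
2^t∸1≥1 t≥1 = ∸-monoˡ-≤ 1 (^-monoʳ-≤ 2 t≥1)

-- For w coprime to q, squaring t times fixes w iff w ^ (2 ^ t - 1) ≡ 1:
-- cancel one factor w from w ^ (2 ^ t) ≡ w.
unit-periodic⇒powerIsOne : ∀ {q w t} → Coprime w q → Periodic q w t → PowerIsOne q w (2 ^ t ∸ 1)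
unit-periodic⇒powerIsOne {q} {w} {t} w⊥q wt = ≈-cancelˡ w⊥q (begin
  w * w ^ (2 ^ t ∸ 1)   ≡⟨ cong (w ^_) (2^t≡1+[2^t∸1] t) ⟨
  w ^ (2 ^ t)           ≈⟨ wt ⟩
  w                     ≡⟨ *-identityʳ w ⟨
  w * 1                 ∎)
  where open ≈-Reasoning q

powerIsOne⇒periodic : ∀ {q w t} → PowerIsOne q w (2 ^ t ∸ 1) → Periodic q w t
powerIsOne⇒periodic {q} {w} {t} w≡1 = begin
  w ^ (2 ^ t)           ≡⟨ cong (w ^_) (2^t≡1+[2^t∸1] t) ⟩
  w * w ^ (2 ^ t ∸ 1)   ≈⟨ ≈-*ˡ w w≡1 ⟩
  w * 1                 ≡⟨ *-identityʳ w ⟩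
  w                     ∎
  where open ≈-Reasoning q

periodic-^ : ∀ {q w t} u → Periodic q w t → Periodic q (w ^ u) t
periodic-^ {q} {w} {t} u wt = subst (_≈ w ^ u [mod q ]) (^-comm w (2 ^ t) u) (≈-^ u wt)

periodic-* : ∀ {q a b t} → Periodic q a t → Periodic q b t → Periodic q (a * b) t
periodic-* {q} {a} {b} {t} at bt = subst (_≈ a * b [mod q ]) (sym (*-^ a b (2 ^ t))) (≈-* at bt)

-- If a unit z has the largest minimal period L among all elements, then the
-- minimal period a of every unit y divides L: an element w = y ^ u * z ^ v of
-- order lcm (ord y) (ord z) has a minimal period P ≤ L with y and z both
-- P-periodic, so L ∣ P (forcing P = L) and a ∣ P.
unit-period-divides : ∀ {q y z a L} → Coprime y q → Coprime z q →
                      MinimalPeriod q y a → MinimalPeriod q z L →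
                      (∀ w P → MinimalPeriod q w P → P ≤ L) → a ∣ L
unit-period-divides {q} {y} {z} {a} {L} y⊥q z⊥q
                    y-period@(a≥1 , ya , _) z-period@(L≥1 , zL , _) maximal =
  subst (a ∣_) P≡L (least-divides periodic-closed y-period (period-P y-order (proj₁ common)))
  where
  y-order : Σ ℕ (Order q y)
  y-order = order-exists (2^t∸1≥1 a≥1) (unit-periodic⇒powerIsOne {t = a} y⊥q ya)
  z-order : Σ ℕ (Order q z)
  z-order = order-exists (2^t∸1≥1 L≥1) (unit-periodic⇒powerIsOne {t = L} z⊥q zL)
  combined = lcm-order (proj₂ y-order) (proj₂ z-order)
  u = proj₁ combined
  v = proj₁ (proj₂ combined)
  w = y ^ u * z ^ v
  w-periodic : Periodic q w (a * L)
  w-periodic = periodic-* {t = a * L}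
    (periodic-^ {t = a * L} u (periodic-multiple {k = a} ya (ℕ∣.m∣m*n L)))
    (periodic-^ {t = a * L} v (periodic-multiple {k = L} zL (ℕ∣.n∣m*n a)))
  w-minimal : Σ ℕ (MinimalPeriod q w)
  w-minimal = minimalPeriod-exists (*-mono-≤ a≥1 L≥1) w-periodic
  P = proj₁ w-minimal
  w-period = proj₂ w-minimal
  w⊥q : Coprime w q
  w⊥q = coprime-*ˡ (coprime-^ˡ u y⊥q) (coprime-^ˡ v z⊥q)
  common : proj₁ y-order ∣ 2 ^ P ∸ 1 × proj₁ z-order ∣ 2 ^ P ∸ 1
  common = proj₂ (proj₂ combined) (2 ^ P ∸ 1)
             (unit-periodic⇒powerIsOne {t = P} w⊥q (proj₁ (proj₂ w-period)))
  period-P : ∀ {x} → (order : Σ ℕ (Order q x)) → proj₁ order ∣ 2 ^ P ∸ 1 → Periodic q x P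
  period-P (_ , _ , xd≡1 , _) d∣N = powerIsOne⇒periodic {t = P} (powerIsOne-multiple xd≡1 d∣N)
  P≡L : P ≡ L
  P≡L = ≤-antisym (maximal w P w-period)
    (ℕ∣.∣⇒≤ {{ℕ.>-nonZero (proj₁ w-period)}} (least-divides periodic-closed z-period (period-P z-order (proj₂ common))))

-- Used to find an exponent 2^(s t) ≥ s that is also a period.
n≤2^n : ∀ n → n ≤ 2 ^ n
n≤2^n zero    = z≤n
n≤2^n (suc n) = subst (suc n ≤_) (cong (λ x → 2 ^ n + x) (sym (+-identityʳ (2 ^ n))))
                      (+-mono-≤ (m^n>0 2 n) (n≤2^n n))

p^s∣[p*c]^N : ∀ p c {s N} → s ≤ N → p ^ s ∣ (p * c) ^ N
p^s∣[p*c]^N p c {s} {N} s≤N = ℕ∣.∣-trans p^s∣p^N (subst (p ^ N ∣_) (sym (*-^ p c N)) (ℕ∣.m∣m*n (c ^ N)))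
  where
  p^s∣p^N : p ^ s ∣ p ^ N
  p^s∣p^N = subst (p ^ s ∣_) (trans (sym (^-distribˡ-+-* p (N ∸ s) s)) (cong (p ^_) (m∸n+n≡m s≤N)))
                  (ℕ∣.n∣m*n (p ^ (N ∸ s)))

-- Modulo p ^ s a periodic multiple of p is nilpotent and periodic, hence 0,
-- so it is fixed by a single squaring.
nonunit-period : ∀ {p s w t} → p ∣ w → 1 ≤ t → Periodic (p ^ s) w t → Periodic (p ^ s) w 1
nonunit-period {p} {s} {w} {t} (divides c refl) t≥1 wt = ≈-trans (≈-^ 2 w≈0) (≈-sym w≈0)
  where
  N = 2 ^ (s * t)
  s≤N : s ≤ N
  s≤N = ≤-trans (m≤m*n s t {{ℕ.>-nonZero t≥1}}) (n≤2^n (s * t))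
  w≈0 : c * p ≈ 0 [mod p ^ s ]
  w≈0 = ≈-trans (≈-sym (multiples periodic-closed wt s))
                (∣⇒≈0 (subst (λ x → p ^ s ∣ x ^ N) (*-comm p c) (p^s∣[p*c]^N p c s≤N)))

-- If L is the maximal cycle length modulo p ^ s then it is the period
-- exponent: multiples of p have minimal period 1, and units are handled by
-- unit-period-divides applied to an element z of minimal period L.
prime-power-exponent : ∀ {p s L} → Prime p → IsL (p ^ s) L → PeriodExponent (p ^ s) L
prime-power-exponent {p} {s} {L} pp isL = (z , z-period) , divides-L
  where
  instance
    p^s≢0 : NonZero (p ^ s)
    p^s≢0 = m^n≢0 p s {{prime⇒nonZero pp}}
  z = proj₁ (IsL⇒attained isL)
  z-period = proj₂ (IsL⇒attained isL)
  nonunit-period-one : ∀ {y a} → p ∣ y → MinimalPeriod (p ^ s) y a → a ∣ 1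
  nonunit-period-one p∣y minimal@(a≥1 , ya , _) =
    least-divides periodic-closed minimal (nonunit-period {s = s} p∣y a≥1 ya)
  divides-L : ∀ y a → MinimalPeriod (p ^ s) y a → a ∣ L
  divides-L y a y-period with p ℕ∣.∣? y | p ℕ∣.∣? z
  ... | yes p∣y | _ = ℕ∣.∣-trans (nonunit-period-one p∣y y-period) (ℕ∣.1∣ L)
  ... | no _ | yes p∣z = subst (_∣ L) (sym a≡1) (ℕ∣.1∣ L)
    where
    a≡1 : a ≡ 1
    a≡1 = ≤-antisym (≤-trans (IsL-maximal isL y-period) (ℕ∣.∣⇒≤ (nonunit-period-one p∣z z-period)))
                    (proj₁ y-period)
  ... | no p∤y | no p∤z =
    unit-period-divides (coprime-^ʳ s (prime∤⇒coprime pp p∤y)) (coprime-^ʳ s (prime∤⇒coprime pp p∤z))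
                        y-period z-period (λ _ _ → IsL-maximal isL)

prime-power : ℕ × ℕ → ℕ
prime-power (p , s) = p ^ s

product-positive : ∀ fs → All (λ ps → Prime (proj₁ ps)) fs → 1 ≤ product (map prime-power fs)
product-positive []             []         = s≤s z≤n
product-positive ((p , s) ∷ fs) (pp ∷ pps) =
  *-mono-≤ (m^n>0 p {{prime⇒nonZero pp}} s) (product-positive fs pps)

coprime-to-rest : ∀ {p} s → Prime p → ∀ fs → All (λ ps → Prime (proj₁ ps)) fs →
                  All (p ≢_) (map proj₁ fs) → Coprime (p ^ s) (product (map prime-power fs))
coprime-to-rest s pp []               []           []           = coprime-1ʳ
coprime-to-rest s pp ((p′ , s′) ∷ fs) (pp′ ∷ pps) (p≢p′ ∷ p∉fs) =
  coprime-*ʳ (coprime-^ˡ s (coprime-^ʳ s′ (distinct-primes-coprime pp pp′ p≢p′)))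
             (coprime-to-rest s pp fs pps p∉fs)

factorisation-exponent : ∀ fs ls → All (λ ps → Prime (proj₁ ps)) fs → Unique (map proj₁ fs) →
                         Pointwise (λ ps l → IsL (prime-power ps) l) fs ls →
                         PeriodExponent (product (map prime-power fs)) (lcmList ls)
factorisation-exponent []             []       []          []                 []           = exponent-one
factorisation-exponent ((p , s) ∷ fs) (l ∷ ls) (pp ∷ pps) (p∉fs ∷ distinct) (isL ∷ isLs) =
  exponent-* (coprime-to-rest s pp fs pps p∉fs)
             (prime-power-exponent {s = s} pp isL) (factorisation-exponent fs ls pps distinct isLs)

proposition5 : (m : ℕ) → Composite m → (fs : List (ℕ × ℕ)) →
               IsPrimeFactorisation m fs →
               (ls : List ℕ) →
               Pointwise (λ ps l → IsL (proj₁ ps ^ proj₂ ps) l) fs ls →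
               IsL m (lcmList ls)
proposition5 m _ fs (primes , distinct , _ , m≡∏) ls isLs =
  subst (λ n → IsL n (lcmList ls)) (sym m≡∏)
    (exponent⇒IsL {{ℕ.>-nonZero (product-positive fs primes)}}
      (factorisation-exponent fs ls primes distinct isLs))
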